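{- Let $G$ be any graph on $[n]$, $r$ a positive integer and $k$ a real number. Let $\mathcal{M}:\mathcal{P}(n,2r)\to\mathbb{R}$ be the linear map defined on multilinear monomials by $\mathcal{M}(X_I)=\deg_G(I)\cdot\frac{k(k-1)\cdots(k-|I|+1)}{2r(2r-1)\cdots(2r-|I|+1)}$ for $I\subseteq[n]$, $|I|\le 2r$, and extended to all of $\mathcal{P}(n,2r)$ by linearity after reducing every individual variable exponent $\ge1$ to $1$ (i.e. $\mathcal{M}(P)=\mathcal{M}(\tilde P)$ where $\tilde P$ is the multilinearization of $P$). Then (1) $\mathcal{M}(X_I)=0$ for every $I$ with $|I|\le 2r$ that is not a clique in $G$, and (2) $\mathcal{M}\big((\sum_{i=1}^n x_i-k)X_I\big)=0$ for every $I\subseteq[n]$ with $|I|<2r$.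
   Context: $\mathcal{P}(n,2r)$ is the space of real polynomials in $x_1,\dots,x_n$ of total degree at most $2r$; $X_I=\prod_{i\in I}x_i$ (with $X_\emptyset=1$). For $I\subseteq[n]$, $|I|\le 2r$, $\deg_G(I)$ is the number of sets $S\subseteq[n]$ with $I\subseteq S$, $|S|=2r$ and $S$ a clique in $G$. Sets of size at most $1$ count as cliques. -}

module Defs where

open import Level using (Level; _⊔_) renaming (suc to lsuc)
open import Algebra.Bundles using (CommutativeRing)
open import Data.Nat using (ℕ; zero; suc; _∸_; _≡ᵇ_; _≤ᵇ_)
import Data.Nat as ℕ
open import Data.Bool using (Bool; true; false; _∧_; _∨_; not; if_then_else_)
open import Data.Fin using (Fin)
open import Data.Fin.Properties using (_≟_)
open import Data.Fin.Subset using (Subset; ∣_∣)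
open import Data.Vec using (Vec; []; _∷_; lookup; zipWith; replicate; tabulate)
open import Data.List using (List; []; _∷_; _++_; map; length; filterᵇ; allFin;  foldr; cartesianProductWith)
open import Data.Product using (_×_; _,_)
open import Relation.Nullary.Decidable using (⌊_⌋)
open import Relation.Binary.PropositionalEquality using (_≡_)

record Graph (n : ℕ) : Set where
  field
    adj    : Fin n → Fin n → Bool
    sym    : ∀ i j → adj i j ≡ adj j i
    irrefl : ∀ i → adj i i ≡ false
open Graph public

allᵇ : ∀ {a} {A : Set a} → (A → Bool) → List A → Bool
allᵇ p = foldr (λ x b → p x ∧ b) true

isCliqueᵇ : ∀ {n} → Graph n → Subset n → Bool
isCliqueᵇ {n} G S =
  allᵇ (λ i → allᵇ (λ j →
        not (lookup S i ∧ lookup S j ∧ not ⌊ i ≟ j ⌋) ∨ adj G i j)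
      (allFin n)) (allFin n)

IsClique : ∀ {n} → Graph n → Subset n → Set
IsClique G S = isCliqueᵇ G S ≡ true

_⊆ᵇ_ : ∀ {n} → Subset n → Subset n → Bool
_⊆ᵇ_ {n} I S = allᵇ (λ i → not (lookup I i) ∨ lookup S i) (allFin n)

allSubsets : (n : ℕ) → List (Subset n)
allSubsets zero    = [] ∷ []
allSubsets (suc n) = map (false ∷_) (allSubsets n) ++ map (true ∷_) (allSubsets n)

-- deg_G(I) for the parameter 2r (here passed as m = 2r):
-- number of S ⊆ [n] with I ⊆ S, |S| = m and S a clique of G.
degG : ∀ {n} → Graph n → (m : ℕ) → Subset n → ℕ
degG {n} G m I =
  length (filterᵇ (λ S → (I ⊆ᵇ S) ∧ (∣ S ∣ ≡ᵇ m) ∧ isCliqueᵇ G S) (allSubsets n))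

fallingℕ : ℕ → ℕ → ℕ
fallingℕ a zero    = 1
fallingℕ a (suc j) = fallingℕ a j ℕ.* (a ∸ j)

-- Scalars.  The paper takes real scalars; we work over an arbitrary
-- commutative ring in which every positive integer is invertible
-- (a ℚ-algebra), which includes ℝ.

module RingDefs {c ℓ : Level} (R : CommutativeRing c ℓ) where
  open CommutativeRing R

  ι : ℕ → Carrier
  ι zero    = 0#
  ι (suc m) = 1# + ι m

  falling : Carrier → ℕ → Carrier
  falling k zero    = 1#
  falling k (suc j) = falling k j * (k - ι j)

  Σ : List Carrier → Carrier
  Σ = foldr _+_ 0#

record QAlgebra (c ℓ : Level) : Set (lsuc (c ⊔ ℓ)) where
  field
    cring : CommutativeRing c ℓ
  open CommutativeRing cring
  open RingDefs cring
  field
    inv         : ℕ → Carrier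
    inv-correct : ∀ m → ι (suc m) * inv (suc m) ≈ 1#

module PolyDefs {c ℓ : Level} (Q : QAlgebra c ℓ) where
  open QAlgebra Q
  open CommutativeRing cring hiding (Carrier; _≈_; 0#; -_)
  open RingDefs cring public
  open CommutativeRing cring public using (Carrier; _≈_; 0#; -_)

  -- Polynomials in x_1..x_n with coefficients in R, as finite formal sums
  -- of terms c · x^α (α an exponent vector).
  Term : ℕ → Set c
  Term n = Carrier × Vec ℕ n

  Poly : ℕ → Set c
  Poly n = List (Term n)

  _+ₚ_ : ∀ {n} → Poly n → Poly n → Poly n
  _+ₚ_ = _++_

  _*ₚ_ : ∀ {n} → Poly n → Poly n → Poly n
  _*ₚ_ = cartesianProductWith (λ { (a , α) (b , β) → (a * b , zipWith ℕ._+_ α β) })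

  constₚ : ∀ {n} → Carrier → Poly n
  constₚ {n} a = (a , replicate n 0) ∷ []

  varₚ : ∀ {n} → Fin n → Poly n
  varₚ {n} i = (1# , tabulate (λ j → if ⌊ i ≟ j ⌋ then 1 else 0)) ∷ []

  Xₚ : ∀ {n} → Subset n → Poly n
  Xₚ I = (1# , Data.Vec.map (λ b → if b then 1 else 0) I) ∷ []

  sumVars : (n : ℕ) → Poly n
  sumVars n = Data.List.concatMap varₚ (allFin n)

  -- multilinearization of a monomial: its support (exponents ≥ 1 ↦ 1)
  support : ∀ {n} → Vec ℕ n → Subset n
  support = Data.Vec.map (λ e → not (e ≡ᵇ 0))

  -- M on multilinear monomials (parameters: graph G, m = 2r, scalar k):
  -- M(X_I) = deg_G(I) · k(k-1)...(k-|I|+1) / (2r(2r-1)...(2r-|I|+1)).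
  -- (For |I| > 2r we have deg_G(I) = 0, so the value is 0 there.)
  Mmono : ∀ {n} → Graph n → ℕ → Carrier → Subset n → Carrier
  Mmono G m k I =
    ι (degG G m I) * (falling k ∣ I ∣ * inv (fallingℕ m ∣ I ∣))

  M : ∀ {n} → Graph n → ℕ → Carrier → Poly n → Carrier
  M G m k P = Σ (map (λ { (a , α) → a * Mmono G m k (support α) }) P)

module Submission where

-- Proof idea.  Write m = 2r and c_s = k(k−1)⋯(k−s+1) / (m(m−1)⋯(m−s+1)),
-- so that M(X_J) = deg_G(J) · c_|J|.
--
-- (1) A set containing a non-clique is not a clique, so deg_G(I) = 0 and
--     M(X_I) = 0.
-- (2) x_i X_I multilinearises to X_{I ∪ {i}}, hence
--       M((Σ_i x_i − k) X_I) = Σ_i M(X_{I ∪ {i}}) − k M(X_I).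
--     The indices i ∈ I contribute |I| · M(X_I).  For i ∉ I we double count:
--     every m-clique S ⊇ I contains exactly m − |I| sets I ∪ {i}, so
--       Σ_{i ∉ I} deg_G(I ∪ {i}) = deg_G(I) · (m − |I|),
--     and the coefficients satisfy  s c_s + (m − s) c_{s+1} = k c_s  for s < m.
--     Together  Σ_i M(X_{I ∪ {i}}) = k M(X_I),  which gives (2).

open import Defs
open import Level using (Level)
open import Algebra.Bundles using (CommutativeRing)
open import Data.Nat using (ℕ; _≤_; _<_; _*_)
open import Data.Fin.Subset using (Subset; ∣_∣)
open import Data.Product using (_×_)
open import Relation.Nullary using (¬_)

import Data.Nat as ℕ
open import Data.Nat using (zero; suc; _∸_; _≡ᵇ_; NonZero; >-nonZero)
import Data.Nat.Properties as ℕₚ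
open import Data.Nat.Solver using (module +-*-Solver)
open import Data.Bool using (Bool; true; false; _∧_; _∨_; not; if_then_else_; T)
import Data.Bool.Properties as Boolₚ
open import Data.Fin using (Fin; zero; suc)
open import Data.Fin.Properties using (_≟_)
open import Data.Fin.Subset using (⊥; ⁅_⁆; _∪_)
open import Data.Fin.Subset.Properties using (∪-identityˡ)
open import Data.Vec using (Vec; []; _∷_; lookup; zipWith)
import Data.Vec as Vec
import Data.Vec.Properties as Vecₚ
open import Data.List using (List; []; _∷_; _++_; length; filterᵇ; allFin; tabulate; concatMap)
import Data.List.Properties as Listₚ
open import Data.Product using (_,_; proj₁; proj₂)
open import Data.Empty using (⊥-elim)
open import Function using (_∘_)
open import Relation.Nullary.Decidable using (⌊_⌋; yes; no)
open import Relation.Binary.PropositionalEquality as ≡ using (_≡_; refl; cong; cong₂)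
import Algebra.Properties.Semiring.Sum
import Algebra.Solver.Ring.NaturalCoefficients.Default
open import Algebra.Properties.Semiring.Sum ℕₚ.+-*-semiring
  using (sum; sum-syntax; sum-cong-≗; sum-replicate-zero; ∑-distrib-+; *-distribˡ-sum)

private
  variable
    n : ℕ

true≡false-elim : true ≡ false → ∀ {a} {A : Set a} → A
true≡false-elim ()

∧-true : ∀ {a b} → a ∧ b ≡ true → a ≡ true × b ≡ true
∧-true {true} {true} _ = refl , refl

allᵇ-mono : ∀ {a} {A : Set a} {p q : A → Bool} →
            (∀ x → p x ≡ true → q x ≡ true) →
            ∀ xs → allᵇ p xs ≡ true → allᵇ q xs ≡ true
allᵇ-mono p⇒q [] _ = refl
allᵇ-mono {p = p} {q} p⇒q (x ∷ xs) all-p with p x in px | q x in qx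
... | true  | true  = allᵇ-mono p⇒q xs all-p
... | true  | false = true≡false-elim (≡.trans (≡.sym (p⇒q x px)) qx)

allᵇ-tabulate : ∀ {a} {A : Set a} (p : A → Bool) (f : Fin n → A) →
                allᵇ p (tabulate f) ≡ allᵇ (p ∘ f) (allFin n)
allᵇ-tabulate {zero}  p f = refl
allᵇ-tabulate {suc n} p f = cong (p (f zero) ∧_)
  (≡.trans (allᵇ-tabulate p (f ∘ suc)) (≡.sym (allᵇ-tabulate (p ∘ f) suc)))

⊆ᵇ-∷ : ∀ a b (I S : Subset n) → (a ∷ I) ⊆ᵇ (b ∷ S) ≡ (not a ∨ b) ∧ (I ⊆ᵇ S)
⊆ᵇ-∷ a b I S =
  cong ((not a ∨ b) ∧_) (allᵇ-tabulate (λ i → not (lookup (a ∷ I) i) ∨ lookup (b ∷ S) i) suc)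

⊆ᵇ-∷⁻ : ∀ a b (I S : Subset n) → (a ∷ I) ⊆ᵇ (b ∷ S) ≡ true →
        (a ≡ true → b ≡ true) × I ⊆ᵇ S ≡ true
⊆ᵇ-∷⁻ a b I S aI⊆bS with ∧-true (≡.trans (≡.sym (⊆ᵇ-∷ a b I S)) aI⊆bS)
... | head , tail = (λ { refl → head }) , tail

⊆ᵇ-lookup : ∀ (I S : Subset n) → I ⊆ᵇ S ≡ true → ∀ i → lookup I i ≡ true → lookup S i ≡ true
⊆ᵇ-lookup (a ∷ I) (b ∷ S) aI⊆bS zero    = proj₁ (⊆ᵇ-∷⁻ a b I S aI⊆bS)
⊆ᵇ-lookup (a ∷ I) (b ∷ S) aI⊆bS (suc i) = ⊆ᵇ-lookup I S (proj₂ (⊆ᵇ-∷⁻ a b I S aI⊆bS)) i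

-- The clique condition for a pair (i , j) only gets weaker when fewer
-- vertices are selected.
pair-condition-mono : ∀ a b a′ b′ c d → (a ≡ true → a′ ≡ true) → (b ≡ true → b′ ≡ true) →
                      not (a′ ∧ b′ ∧ c) ∨ d ≡ true → not (a ∧ b ∧ c) ∨ d ≡ true
pair-condition-mono false b     a′ b′ c d _ _ _ = refl
pair-condition-mono true  false a′ b′ c d _ _ _ = refl
pair-condition-mono true  true  a′ b′ c d a⇒a′ b⇒b′ h
  rewrite a⇒a′ refl | b⇒b′ refl = h

clique-subset : ∀ (G : Graph n) (I S : Subset n) → I ⊆ᵇ S ≡ true → IsClique G S → IsClique G I
clique-subset {n} G I S I⊆S =
  allᵇ-mono (λ i → allᵇ-mono (λ j →
    pair-condition-mono (lookup I i) (lookup I j) (lookup S i) (lookup S j) _ _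
      (⊆ᵇ-lookup I S I⊆S i) (⊆ᵇ-lookup I S I⊆S j)) (allFin n)) (allFin n)

length-filterᵇ-none : ∀ {a} {A : Set a} (p : A → Bool) → (∀ x → p x ≡ false) →
                      ∀ xs → length (filterᵇ p xs) ≡ 0
length-filterᵇ-none p none [] = refl
length-filterᵇ-none p none (x ∷ xs) rewrite none x = length-filterᵇ-none p none xs

-- A non-clique lies in no clique, so its degree vanishes.
degG-nonclique : ∀ (G : Graph n) m (I : Subset n) → ¬ IsClique G I → degG G m I ≡ 0
degG-nonclique {n} G m I ¬clique = length-filterᵇ-none _ not-below-clique (allSubsets n)
  where
  not-below-clique : ∀ S → (I ⊆ᵇ S) ∧ (∣ S ∣ ≡ᵇ m) ∧ isCliqueᵇ G S ≡ false
  not-below-clique S with I ⊆ᵇ S in I⊆S | isCliqueᵇ G S in S-clique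
  ... | false | _     = refl
  ... | true  | false = Boolₚ.∧-zeroʳ _
  ... | true  | true  = ⊥-elim (¬clique (clique-subset G I S I⊆S S-clique))

insert-member : ∀ (i : Fin n) (I : Subset n) → lookup I i ≡ true → ⁅ i ⁆ ∪ I ≡ I
insert-member zero    (true ∷ I) refl = cong (true ∷_) (∪-identityˡ I)
insert-member (suc i) (a ∷ I)    i∈I  = cong (a ∷_) (insert-member i I i∈I)

insert-card : ∀ (i : Fin n) (I : Subset n) → lookup I i ≡ false → ∣ ⁅ i ⁆ ∪ I ∣ ≡ suc ∣ I ∣
insert-card zero    (false ∷ I) refl = cong (suc ∘ ∣_∣) (∪-identityˡ I)
insert-card (suc i) (true ∷ I)  i∉I  = cong suc (insert-card i I i∉I)
insert-card (suc i) (false ∷ I) i∉I  = insert-card i I i∉I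

insert-⊆ᵇ : ∀ (i : Fin n) (I S : Subset n) → (⁅ i ⁆ ∪ I) ⊆ᵇ S ≡ (I ⊆ᵇ S) ∧ lookup S i
insert-⊆ᵇ zero (a ∷ I) (b ∷ S) = begin
  (⁅ zero ⁆ ∪ (a ∷ I)) ⊆ᵇ (b ∷ S) ≡⟨ ⊆ᵇ-∷ true b (⊥ ∪ I) S ⟩
  b ∧ ((⊥ ∪ I) ⊆ᵇ S)            ≡⟨ cong (λ J → b ∧ (J ⊆ᵇ S)) (∪-identityˡ I) ⟩
  b ∧ (I ⊆ᵇ S)                  ≡⟨ head-last a b (I ⊆ᵇ S) ⟩
  ((not a ∨ b) ∧ (I ⊆ᵇ S)) ∧ b  ≡⟨ cong (_∧ b) (≡.sym (⊆ᵇ-∷ a b I S)) ⟩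
  ((a ∷ I) ⊆ᵇ (b ∷ S)) ∧ b      ∎
  where
  open ≡.≡-Reasoning
  head-last : ∀ a b x → b ∧ x ≡ ((not a ∨ b) ∧ x) ∧ b
  head-last a false x = ≡.sym (Boolₚ.∧-zeroʳ _)
  head-last a true  x rewrite Boolₚ.∨-zeroʳ (not a) = ≡.sym (Boolₚ.∧-identityʳ x)
insert-⊆ᵇ (suc i) (a ∷ I) (b ∷ S) = begin
  (⁅ suc i ⁆ ∪ (a ∷ I)) ⊆ᵇ (b ∷ S)         ≡⟨ ⊆ᵇ-∷ a b (⁅ i ⁆ ∪ I) S ⟩
  (not a ∨ b) ∧ ((⁅ i ⁆ ∪ I) ⊆ᵇ S)         ≡⟨ cong ((not a ∨ b) ∧_) (insert-⊆ᵇ i I S) ⟩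
  (not a ∨ b) ∧ ((I ⊆ᵇ S) ∧ lookup S i)    ≡⟨ ≡.sym (Boolₚ.∧-assoc (not a ∨ b) _ _) ⟩
  ((not a ∨ b) ∧ (I ⊆ᵇ S)) ∧ lookup S i    ≡⟨ cong (_∧ lookup S i) (≡.sym (⊆ᵇ-∷ a b I S)) ⟩
  ((a ∷ I) ⊆ᵇ (b ∷ S)) ∧ lookup S i        ∎
  where open ≡.≡-Reasoning

-- The indicator of a Boolean (the exponents of X_I are ind of its entries).
ind : Bool → ℕ
ind b = if b then 1 else 0

ind-∧ : ∀ a b → ind (a ∧ b) ≡ ind a * ind b
ind-∧ false b = refl
ind-∧ true  b = ≡.sym (ℕₚ.+-identityʳ (ind b))

ind-guard : ∀ b {x y} → (b ≡ true → x ≡ y) → ind b * x ≡ ind b * y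
ind-guard false _   = refl
ind-guard true  x≡y = cong (ℕ._+ 0) (x≡y refl)

∑-ind-lookup : ∀ (I : Subset n) → ∑[ i < n ] ind (lookup I i) ≡ ∣ I ∣
∑-ind-lookup []          = refl
∑-ind-lookup (true ∷ I)  = cong suc (∑-ind-lookup I)
∑-ind-lookup (false ∷ I) = ∑-ind-lookup I

card-difference : ∀ (I S : Subset n) → I ⊆ᵇ S ≡ true →
                  ∑[ i < n ] ind (not (lookup I i) ∧ lookup S i) ℕ.+ ∣ I ∣ ≡ ∣ S ∣
card-difference []      []      _     = refl
card-difference (a ∷ I) (b ∷ S) aI⊆bS with ⊆ᵇ-∷⁻ a b I S aI⊆bS
... | a⇒b , I⊆S with a | b
...   | true  | true  = ≡.trans (ℕₚ.+-suc _ _) (cong suc (card-difference I S I⊆S))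
...   | true  | false = true≡false-elim (≡.sym (a⇒b refl))
...   | false | true  = cong suc (card-difference I S I⊆S)
...   | false | false = card-difference I S I⊆S

-- Double counting.  For a family of m-element sets, each member S
-- containing I contains exactly m − |I| sets of the form I ∪ {i}, i ∉ I.

-- For a single candidate set S (admitted when b holds).
extensions-within : ∀ m (I S : Subset n) b → (b ≡ true → ∣ S ∣ ≡ m) →
  ∑[ i < n ] (ind (not (lookup I i)) * ind (((⁅ i ⁆ ∪ I) ⊆ᵇ S) ∧ b))
    ≡ ind ((I ⊆ᵇ S) ∧ b) * (m ∸ ∣ I ∣)
extensions-within {n} m I S b size = begin
  ∑[ i < n ] (ind (not (lookup I i)) * ind (((⁅ i ⁆ ∪ I) ⊆ᵇ S) ∧ b))
    ≡⟨ sum-cong-≗ regroup ⟩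
  ∑[ i < n ] (ind ((I ⊆ᵇ S) ∧ b) * ind (not (lookup I i) ∧ lookup S i))
    ≡⟨ ≡.sym (*-distribˡ-sum (ind ((I ⊆ᵇ S) ∧ b)) (λ i → ind (not (lookup I i) ∧ lookup S i))) ⟩
  ind ((I ⊆ᵇ S) ∧ b) * ∑[ i < n ] ind (not (lookup I i) ∧ lookup S i)
    ≡⟨ ind-guard ((I ⊆ᵇ S) ∧ b) difference ⟩
  ind ((I ⊆ᵇ S) ∧ b) * (m ∸ ∣ I ∣) ∎
  where
  open ≡.≡-Reasoning
  open +-*-Solver
  regroup : ∀ i → ind (not (lookup I i)) * ind (((⁅ i ⁆ ∪ I) ⊆ᵇ S) ∧ b)
                ≡ ind ((I ⊆ᵇ S) ∧ b) * ind (not (lookup I i) ∧ lookup S i)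
  regroup i = begin
    ind i∉I * ind (((⁅ i ⁆ ∪ I) ⊆ᵇ S) ∧ b)
      ≡⟨ cong (λ t → ind i∉I * ind (t ∧ b)) (insert-⊆ᵇ i I S) ⟩
    ind i∉I * ind (((I ⊆ᵇ S) ∧ i∈S) ∧ b)
      ≡⟨ cong (ind i∉I *_) (≡.trans (ind-∧ _ b) (cong (_* ind b) (ind-∧ (I ⊆ᵇ S) i∈S))) ⟩
    ind i∉I * ((ind (I ⊆ᵇ S) * ind i∈S) * ind b)
      ≡⟨ solve 4 (λ x y z w → x :* ((y :* z) :* w) := (y :* w) :* (x :* z)) refl
               (ind i∉I) (ind (I ⊆ᵇ S)) (ind i∈S) (ind b) ⟩
    (ind (I ⊆ᵇ S) * ind b) * (ind i∉I * ind i∈S)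
      ≡⟨ ≡.sym (cong₂ _*_ (ind-∧ (I ⊆ᵇ S) b) (ind-∧ i∉I i∈S)) ⟩
    ind ((I ⊆ᵇ S) ∧ b) * ind (i∉I ∧ i∈S) ∎
    where
    i∉I = not (lookup I i)
    i∈S = lookup S i
  difference : (I ⊆ᵇ S) ∧ b ≡ true → ∑[ i < n ] ind (not (lookup I i) ∧ lookup S i) ≡ m ∸ ∣ I ∣
  difference I⊆S∧b with ∧-true I⊆S∧b
  ... | I⊆S , b-true = begin
    ∑[ i < n ] ind (not (lookup I i) ∧ lookup S i)
      ≡⟨ ≡.sym (ℕₚ.m+n∸n≡m _ ∣ I ∣) ⟩
    ∑[ i < n ] ind (not (lookup I i) ∧ lookup S i) ℕ.+ ∣ I ∣ ∸ ∣ I ∣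
      ≡⟨ cong (_∸ ∣ I ∣) (≡.trans (card-difference I S I⊆S) (size b-true)) ⟩
    m ∸ ∣ I ∣ ∎

containing : List (Subset n) → (Subset n → Bool) → Subset n → ℕ
containing L P J = length (filterᵇ (λ S → (J ⊆ᵇ S) ∧ P S) L)

length-filterᵇ-∷ : ∀ {a} {A : Set a} (p : A → Bool) x xs →
                   length (filterᵇ p (x ∷ xs)) ≡ ind (p x) ℕ.+ length (filterᵇ p xs)
length-filterᵇ-∷ p x xs with p x
... | true  = refl
... | false = refl

double-count : ∀ m (P : Subset n → Bool) → (∀ S → P S ≡ true → ∣ S ∣ ≡ m) →
  ∀ L (I : Subset n) →
  ∑[ i < n ] (ind (not (lookup I i)) * containing L P (⁅ i ⁆ ∪ I)) ≡ containing L P I * (m ∸ ∣ I ∣)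
double-count {n} m P size [] I =
  ≡.trans (sum-cong-≗ (λ i → ℕₚ.*-zeroʳ (ind (not (lookup I i))))) (sum-replicate-zero n)
double-count {n} m P size (S ∷ L) I = begin
  ∑[ i < n ] (ind∉ i * containing (S ∷ L) P (⁅ i ⁆ ∪ I))
    ≡⟨ sum-cong-≗ (λ i → ≡.trans (cong (ind∉ i *_) (length-filterᵇ-∷ (λ T → ((⁅ i ⁆ ∪ I) ⊆ᵇ T) ∧ P T) S L))
                                  (ℕₚ.*-distribˡ-+ (ind∉ i) _ _)) ⟩
  ∑[ i < n ] (ind∉ i * ind (((⁅ i ⁆ ∪ I) ⊆ᵇ S) ∧ P S) ℕ.+ ind∉ i * containing L P (⁅ i ⁆ ∪ I))
    ≡⟨ ∑-distrib-+ (λ i → ind∉ i * ind (((⁅ i ⁆ ∪ I) ⊆ᵇ S) ∧ P S))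
                   (λ i → ind∉ i * containing L P (⁅ i ⁆ ∪ I)) ⟩
  ∑[ i < n ] (ind∉ i * ind (((⁅ i ⁆ ∪ I) ⊆ᵇ S) ∧ P S)) ℕ.+ ∑[ i < n ] (ind∉ i * containing L P (⁅ i ⁆ ∪ I))
    ≡⟨ cong₂ ℕ._+_ (extensions-within m I S (P S) (size S)) (double-count m P size L I) ⟩
  ind ((I ⊆ᵇ S) ∧ P S) * (m ∸ ∣ I ∣) ℕ.+ containing L P I * (m ∸ ∣ I ∣)
    ≡⟨ ≡.sym (ℕₚ.*-distribʳ-+ (m ∸ ∣ I ∣) (ind ((I ⊆ᵇ S) ∧ P S)) (containing L P I)) ⟩
  (ind ((I ⊆ᵇ S) ∧ P S) ℕ.+ containing L P I) * (m ∸ ∣ I ∣)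
    ≡⟨ cong (_* (m ∸ ∣ I ∣)) (≡.sym (length-filterᵇ-∷ (λ T → (I ⊆ᵇ T) ∧ P T) S L)) ⟩
  containing (S ∷ L) P I * (m ∸ ∣ I ∣) ∎
  where
  open ≡.≡-Reasoning
  ind∉ : Fin n → ℕ
  ind∉ i = ind (not (lookup I i))

degG-double-count : ∀ (G : Graph n) m (I : Subset n) →
  ∑[ i < n ] (ind (not (lookup I i)) * degG G m (⁅ i ⁆ ∪ I)) ≡ degG G m I * (m ∸ ∣ I ∣)
degG-double-count {n} G m I = double-count m (λ S → (∣ S ∣ ≡ᵇ m) ∧ isCliqueᵇ G S) size (allSubsets n) I
  where
  size : ∀ S → (∣ S ∣ ≡ᵇ m) ∧ isCliqueᵇ G S ≡ true → ∣ S ∣ ≡ m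
  size S h = ℕₚ.≡ᵇ⇒≡ ∣ S ∣ m (≡.subst T (≡.sym (proj₁ (∧-true h))) _)

fallingℕ-nonZero : ∀ m s → s ≤ m → NonZero (fallingℕ m s)
fallingℕ-nonZero m zero    _   = _
fallingℕ-nonZero m (suc s) s<m =
  ℕₚ.m*n≢0 (fallingℕ m s) (m ∸ s) {{fallingℕ-nonZero m s (ℕₚ.<⇒≤ s<m)}}
                                  {{>-nonZero (ℕₚ.m<n⇒0<n∸m s<m)}}

module Evaluation {c ℓ : Level} (Q : QAlgebra c ℓ) where
  open QAlgebra Q using (cring; inv; inv-correct)
  open PolyDefs Q
  open CommutativeRing cring
    using (1#; _+_; _-_; setoid; +-cong; *-cong; +-identityˡ; *-identityˡ;
           *-identityʳ; zeroˡ; distribʳ; +-assoc; -‿inverseʳ; semiring; commutativeSemiring; +-abelianGroup)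
    renaming (_*_ to _·_; refl to ≈-refl; sym to ≈-sym; trans to ≈-trans)
  open import Relation.Binary.Reasoning.Setoid setoid
  open import Algebra.Properties.Semiring.Mult semiring
    using (×-homo-+; ×1-homo-*) renaming (_×_ to _×ᴿ_)
  open import Algebra.Properties.AbelianGroup +-abelianGroup using (xyx⁻¹≈y)
  module ∑ᴿ = Algebra.Properties.Semiring.Sum semiring
  open Algebra.Solver.Ring.NaturalCoefficients.Default commutativeSemiring
    using (solve; _:=_; _:+_; _:*_; con)

  ι-multiple : ∀ m → ι m ≡ m ×ᴿ 1#
  ι-multiple zero    = refl
  ι-multiple (suc m) = cong (1# +_) (ι-multiple m)

  ι-+ : ∀ a b → ι (a ℕ.+ b) ≈ ι a + ι b
  ι-+ a b = begin
    ι (a ℕ.+ b)             ≡⟨ ι-multiple (a ℕ.+ b) ⟩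
    (a ℕ.+ b) ×ᴿ 1#         ≈⟨ ×-homo-+ 1# a b ⟩
    a ×ᴿ 1# + b ×ᴿ 1#       ≡⟨ ≡.sym (cong₂ _+_ (ι-multiple a) (ι-multiple b)) ⟩
    ι a + ι b               ∎

  ι-* : ∀ a b → ι (a * b) ≈ ι a · ι b
  ι-* a b = begin
    ι (a * b)               ≡⟨ ι-multiple (a * b) ⟩
    (a * b) ×ᴿ 1#           ≈⟨ ×1-homo-* a b ⟩
    (a ×ᴿ 1#) · (b ×ᴿ 1#)   ≡⟨ ≡.sym (cong₂ _·_ (ι-multiple a) (ι-multiple b)) ⟩
    ι a · ι b               ∎

  ι-sum : ∀ {n} (f : Fin n → ℕ) → ι (sum f) ≈ ∑ᴿ.sum (λ i → ι (f i))
  ι-sum {zero}  f = ≈-refl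
  ι-sum {suc n} f = ≈-trans (ι-+ (f zero) (sum (f ∘ suc))) (+-cong ≈-refl (ι-sum (f ∘ suc)))

  ∑-combination : ∀ {n} (a b : Fin n → ℕ) (A B : Carrier) →
    ∑ᴿ.sum (λ i → ι (a i) · A + ι (b i) · B) ≈ ι (sum a) · A + ι (sum b) · B
  ∑-combination a b A B = begin
    ∑ᴿ.sum (λ i → ι (a i) · A + ι (b i) · B)
      ≈⟨ ∑ᴿ.∑-distrib-+ (λ i → ι (a i) · A) (λ i → ι (b i) · B) ⟩
    ∑ᴿ.sum (λ i → ι (a i) · A) + ∑ᴿ.sum (λ i → ι (b i) · B)
      ≈⟨ +-cong (≈-sym (∑ᴿ.*-distribʳ-sum A (ι ∘ a))) (≈-sym (∑ᴿ.*-distribʳ-sum B (ι ∘ b))) ⟩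
    ∑ᴿ.sum (ι ∘ a) · A + ∑ᴿ.sum (ι ∘ b) · B
      ≈⟨ +-cong (*-cong (≈-sym (ι-sum a)) ≈-refl) (*-cong (≈-sym (ι-sum b)) ≈-refl) ⟩
    ι (sum a) · A + ι (sum b) · B ∎

  ι-inv : ∀ N .{{_ : NonZero N}} → ι N · inv N ≈ 1#
  ι-inv (suc N) = inv-correct N

  inverse-cofactor : ∀ a b x y → a · x ≈ 1# → (a · b) · y ≈ 1# → b · y ≈ x
  inverse-cofactor a b x y ax≈1 aby≈1 = begin
    b · y                 ≈⟨ ≈-sym (*-identityʳ (b · y)) ⟩
    (b · y) · 1#          ≈⟨ *-cong ≈-refl (≈-sym ax≈1) ⟩
    (b · y) · (a · x)     ≈⟨ solve 4 (λ a b x y → (b :* y) :* (a :* x) := ((a :* b) :* y) :* x) ≈-refl a b x y ⟩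
    ((a · b) · y) · x     ≈⟨ *-cong aby≈1 ≈-refl ⟩
    1# · x                ≈⟨ *-identityˡ x ⟩
    x                     ∎

  weight : ℕ → Carrier → ℕ → Carrier
  weight m k s = falling k s · inv (fallingℕ m s)

  weight-step : ∀ m k s → s < m → ι s · weight m k s + ι (m ∸ s) · weight m k (suc s) ≈ k · weight m k s
  weight-step m k s s<m = begin
    ι s · (f · Y) + ι (m ∸ s) · ((f · (k - ι s)) · Z)
      ≈⟨ solve 6 (λ f Y Z t w x → x :* (f :* Y) :+ w :* ((f :* t) :* Z) := f :* (x :* Y :+ t :* (w :* Z)))
               ≈-refl f Y Z (k - ι s) (ι (m ∸ s)) (ι s) ⟩
    f · (ι s · Y + (k - ι s) · (ι (m ∸ s) · Z))
      ≈⟨ *-cong ≈-refl (+-cong ≈-refl (*-cong ≈-refl ratio)) ⟩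
    f · (ι s · Y + (k - ι s) · Y)
      ≈⟨ *-cong ≈-refl (≈-sym (distribʳ Y (ι s) (k - ι s))) ⟩
    f · ((ι s + (k - ι s)) · Y)
      ≈⟨ *-cong ≈-refl (*-cong cancel ≈-refl) ⟩
    f · (k · Y)
      ≈⟨ solve 3 (λ f k Y → f :* (k :* Y) := k :* (f :* Y)) ≈-refl f k Y ⟩
    k · (f · Y) ∎
    where
    D = fallingℕ m s
    f = falling k s
    Y = inv D
    Z = inv (fallingℕ m (suc s))
    instance
      D≢0 : NonZero D
      D≢0 = fallingℕ-nonZero m s (ℕₚ.<⇒≤ s<m)
      D′≢0 : NonZero (fallingℕ m (suc s))
      D′≢0 = fallingℕ-nonZero m (suc s) s<m
    ratio : ι (m ∸ s) · Z ≈ Y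
    ratio = inverse-cofactor (ι D) (ι (m ∸ s)) Y Z (ι-inv D)
              (≈-trans (*-cong (≈-sym (ι-* D (m ∸ s))) ≈-refl) (ι-inv (fallingℕ m (suc s))))
    cancel : ι s + (k - ι s) ≈ k
    cancel = ≈-trans (≈-sym (+-assoc (ι s) k (- ι s))) (xyx⁻¹≈y (ι s) k)

  support-+ : ∀ {n} (α β : Vec ℕ n) → support (zipWith ℕ._+_ α β) ≡ support α ∪ support β
  support-+ []          []      = refl
  support-+ (zero  ∷ α) (b ∷ β) = cong (not (b ≡ᵇ 0) ∷_) (support-+ α β)
  support-+ (suc a ∷ α) (b ∷ β) = cong (true ∷_) (support-+ α β)

  support-indicator : ∀ {n} (I : Subset n) → support (Vec.map ind I) ≡ I
  support-indicator []          = refl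
  support-indicator (true ∷ I)  = cong (true ∷_) (support-indicator I)
  support-indicator (false ∷ I) = cong (false ∷_) (support-indicator I)

  support-zeros : ∀ {n} → support (Vec.tabulate {n = n} (λ _ → 0)) ≡ ⊥
  support-zeros {zero}  = refl
  support-zeros {suc n} = cong (false ∷_) support-zeros

  support-var : ∀ {n} (i : Fin n) →
                support (Vec.tabulate (λ j → if ⌊ i ≟ j ⌋ then 1 else 0)) ≡ ⁅ i ⁆
  support-var {suc n} zero    = cong (true ∷_) support-zeros
  support-var {suc n} (suc i) = cong (false ∷_) (≡.trans
    (cong support (Vecₚ.tabulate-cong (λ j → cong (λ b → if b then 1 else 0) (⌊suc≟suc⌋ i j))))
    (support-var i))
    where
    ⌊suc≟suc⌋ : ∀ (i j : Fin n) → ⌊ suc i ≟ suc j ⌋ ≡ ⌊ i ≟ j ⌋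
    ⌊suc≟suc⌋ i j with i ≟ j
    ... | yes _ = refl
    ... | no  _ = refl

  module _ {n : ℕ} (G : Graph n) (m : ℕ) (k : Carrier) where

    M-++ : ∀ (P R : Poly n) → M G m k (P ++ R) ≈ M G m k P + M G m k R
    M-++ []      R = ≈-sym (+-identityˡ _)
    M-++ (t ∷ P) R = ≈-trans (+-cong ≈-refl (M-++ P R)) (≈-sym (+-assoc _ _ _))

    M-const-X : ∀ a (I : Subset n) → M G m k (constₚ a *ₚ Xₚ I) ≈ a · Mmono G m k I
    M-const-X a I = begin
      (a · 1#) · Mmono G m k (support (zipWith ℕ._+_ (Vec.replicate n 0) (Vec.map ind I))) + 0#
        ≡⟨ cong (λ α → (a · 1#) · Mmono G m k (support α) + 0#)
                (Vecₚ.zipWith-identityˡ ℕₚ.+-identityˡ (Vec.map ind I)) ⟩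
      (a · 1#) · Mmono G m k (support (Vec.map ind I)) + 0#
        ≡⟨ cong (λ J → (a · 1#) · Mmono G m k J + 0#) (support-indicator I) ⟩
      (a · 1#) · Mmono G m k I + 0#
        ≈⟨ solve 2 (λ a x → (a :* con 1) :* x :+ con 0 := a :* x) ≈-refl a (Mmono G m k I) ⟩
      a · Mmono G m k I ∎

    var-term-X : ∀ (i : Fin n) (I : Subset n) →
      (1# · 1#) · Mmono G m k (support (zipWith ℕ._+_ (Vec.tabulate (λ j → if ⌊ i ≟ j ⌋ then 1 else 0))
                                                    (Vec.map ind I)))
        ≈ Mmono G m k (⁅ i ⁆ ∪ I)
    var-term-X i I = begin
      (1# · 1#) · Mmono G m k (support (zipWith ℕ._+_ δᵢ (Vec.map ind I)))
        ≡⟨ cong (λ J → (1# · 1#) · Mmono G m k J)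
                (≡.trans (support-+ δᵢ (Vec.map ind I)) (cong₂ _∪_ (support-var i) (support-indicator I))) ⟩
      (1# · 1#) · Mmono G m k (⁅ i ⁆ ∪ I)
        ≈⟨ solve 1 (λ x → (con 1 :* con 1) :* x := x) ≈-refl (Mmono G m k (⁅ i ⁆ ∪ I)) ⟩
      Mmono G m k (⁅ i ⁆ ∪ I) ∎
      where
      δᵢ = Vec.tabulate (λ j → if ⌊ i ≟ j ⌋ then 1 else 0)

    M-vars-X : ∀ {n′} (g : Fin n′ → Fin n) (I : Subset n) →
      M G m k (concatMap varₚ (tabulate g) *ₚ Xₚ I) ≈ ∑ᴿ.sum (λ j → Mmono G m k (⁅ g j ⁆ ∪ I))
    M-vars-X {zero}   g I = ≈-refl
    M-vars-X {suc n′} g I = +-cong (var-term-X (g zero) I) (M-vars-X (g ∘ suc) I)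

    M-shifted-X : ∀ (I : Subset n) →
      M G m k ((sumVars n +ₚ constₚ (- k)) *ₚ Xₚ I)
        ≈ ∑ᴿ.sum (λ i → Mmono G m k (⁅ i ⁆ ∪ I)) + (- k) · Mmono G m k I
    M-shifted-X I = begin
      M G m k ((sumVars n ++ constₚ (- k)) *ₚ Xₚ I)
        ≡⟨ cong (M G m k) (Listₚ.cartesianProductWith-distribʳ-++ _ (sumVars n) (constₚ (- k)) (Xₚ I)) ⟩
      M G m k ((sumVars n *ₚ Xₚ I) ++ (constₚ (- k) *ₚ Xₚ I))
        ≈⟨ M-++ (sumVars n *ₚ Xₚ I) (constₚ (- k) *ₚ Xₚ I) ⟩
      M G m k (sumVars n *ₚ Xₚ I) + M G m k (constₚ (- k) *ₚ Xₚ I)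
        ≈⟨ +-cong (M-vars-X (λ i → i) I) (M-const-X (- k) I) ⟩
      ∑ᴿ.sum (λ i → Mmono G m k (⁅ i ⁆ ∪ I)) + (- k) · Mmono G m k I ∎

    Mmono-insert : ∀ (I : Subset n) (i : Fin n) →
      Mmono G m k (⁅ i ⁆ ∪ I)
        ≈ ι (ind (lookup I i)) · Mmono G m k I
          + ι (ind (not (lookup I i)) * degG G m (⁅ i ⁆ ∪ I)) · weight m k (suc ∣ I ∣)
    Mmono-insert I i with lookup I i in i∈I
    ... | true rewrite insert-member i I i∈I =
      solve 2 (λ x w → x := (con 1 :+ con 0) :* x :+ con 0 :* w) ≈-refl (Mmono G m k I) (weight m k (suc ∣ I ∣))
    ... | false rewrite insert-card i I i∈I | ℕₚ.*-identityˡ (degG G m (⁅ i ⁆ ∪ I)) =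
      solve 3 (λ x d w → d :* w := con 0 :* x :+ d :* w) ≈-refl
        (Mmono G m k I) (ι (degG G m (⁅ i ⁆ ∪ I))) (weight m k (suc ∣ I ∣))

    ∑-Mmono-insert : ∀ (I : Subset n) → ∣ I ∣ < m →
      ∑ᴿ.sum (λ i → Mmono G m k (⁅ i ⁆ ∪ I)) ≈ k · Mmono G m k I
    ∑-Mmono-insert I s<m = begin
      ∑ᴿ.sum (λ i → Mmono G m k (⁅ i ⁆ ∪ I))
        ≈⟨ ∑ᴿ.sum-cong-≋ (Mmono-insert I) ⟩
      ∑ᴿ.sum (λ i → ι (ind (lookup I i)) · Mmono G m k I
                    + ι (ind (not (lookup I i)) * degG G m (⁅ i ⁆ ∪ I)) · cₛ₊₁)
        ≈⟨ ∑-combination (λ i → ind (lookup I i)) (λ i → ind (not (lookup I i)) * degG G m (⁅ i ⁆ ∪ I))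
                         (Mmono G m k I) cₛ₊₁ ⟩
      ι (∑[ i < n ] ind (lookup I i)) · Mmono G m k I
        + ι (∑[ i < n ] (ind (not (lookup I i)) * degG G m (⁅ i ⁆ ∪ I))) · cₛ₊₁
        ≡⟨ cong₂ (λ a b → ι a · Mmono G m k I + ι b · cₛ₊₁) (∑-ind-lookup I) (degG-double-count G m I) ⟩
      ι s · (ι d · cₛ) + ι (d * (m ∸ s)) · cₛ₊₁
        ≈⟨ +-cong ≈-refl (*-cong (ι-* d (m ∸ s)) ≈-refl) ⟩
      ι s · (ι d · cₛ) + (ι d · ι (m ∸ s)) · cₛ₊₁
        ≈⟨ solve 5 (λ x y z w v → y :* (z :* w) :+ (z :* x) :* v := z :* (y :* w :+ x :* v)) ≈-refl
                   (ι (m ∸ s)) (ι s) (ι d) cₛ cₛ₊₁ ⟩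
      ι d · (ι s · cₛ + ι (m ∸ s) · cₛ₊₁)
        ≈⟨ *-cong ≈-refl (weight-step m k s s<m) ⟩
      ι d · (k · cₛ)
        ≈⟨ solve 3 (λ x y z → x :* (y :* z) := y :* (x :* z)) ≈-refl (ι d) k cₛ ⟩
      k · (ι d · cₛ) ∎
      where
      s = ∣ I ∣
      d = degG G m I
      cₛ = weight m k s
      cₛ₊₁ = weight m k (suc s)

    M-X-nonclique : ∀ (I : Subset n) → ¬ IsClique G I → M G m k (Xₚ I) ≈ 0#
    M-X-nonclique I ¬clique = begin
      1# · Mmono G m k (support (Vec.map ind I)) + 0#
        ≡⟨ cong (λ J → 1# · Mmono G m k J + 0#) (support-indicator I) ⟩
      1# · (ι (degG G m I) · weight m k ∣ I ∣) + 0#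
        ≡⟨ cong (λ d → 1# · (ι d · weight m k ∣ I ∣) + 0#) (degG-nonclique G m I ¬clique) ⟩
      1# · (0# · weight m k ∣ I ∣) + 0#
        ≈⟨ solve 1 (λ w → con 1 :* (con 0 :* w) :+ con 0 := con 0) ≈-refl (weight m k ∣ I ∣) ⟩
      0# ∎

    M-shifted-X-vanishes : ∀ (I : Subset n) → ∣ I ∣ < m →
      M G m k ((sumVars n +ₚ constₚ (- k)) *ₚ Xₚ I) ≈ 0#
    M-shifted-X-vanishes I s<m = begin
      M G m k ((sumVars n +ₚ constₚ (- k)) *ₚ Xₚ I)
        ≈⟨ M-shifted-X I ⟩
      ∑ᴿ.sum (λ i → Mmono G m k (⁅ i ⁆ ∪ I)) + (- k) · Mmono G m k I
        ≈⟨ +-cong (∑-Mmono-insert I s<m) ≈-refl ⟩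
      k · Mmono G m k I + (- k) · Mmono G m k I
        ≈⟨ ≈-sym (distribʳ (Mmono G m k I) k (- k)) ⟩
      (k + - k) · Mmono G m k I
        ≈⟨ *-cong (-‿inverseʳ k) ≈-refl ⟩
      0# · Mmono G m k I
        ≈⟨ zeroˡ (Mmono G m k I) ⟩
      0# ∎

-- Theorem 5, with m = 2r.
mainTheorem5 : ∀ {c ℓ : Level} (Q : QAlgebra c ℓ) (n : ℕ) (G : Graph n) (r : ℕ) → 1 ≤ r →
    (k : PolyDefs.Carrier Q) →
    let open PolyDefs Q in ((I : Subset n) → ∣ I ∣ ≤ 2 * r → ¬ IsClique G I → M G (2 * r) k (Xₚ I) ≈ 0#)
    × ((I : Subset n) → ∣ I ∣ < 2 * r →
    M G (2 * r) k ((sumVars n +ₚ constₚ (- k)) *ₚ Xₚ I) ≈ 0#)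
mainTheorem5 Q n G r _ k =
  (λ I _ ¬clique → M-X-nonclique G (2 * r) k I ¬clique) ,
  (λ I |I|<2r → M-shifted-X-vanishes G (2 * r) k I |I|<2r)
  where open Evaluation Q
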